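{- For any position $G$ of misère partizan Kayles, if Left, moving first in $G+S_1$, has a winning strategy, then Left wins by the move from $G+S_1$ to $G$ (placing her square on the component $S_1$).
   Context: Partizan Kayles is played on $1\times n$ strips of squares; $S_n$ denotes an empty strip of length $n$ ($S_0=0$), so $S_1$ is a single empty cell. Left moves by placing a single square on one empty cell; Right moves by placing a domino covering two adjacent empty cells of the same strip; a placement splits a strip into the strips of empty cells on either side. Positions are disjunctive sums of strips. Under misère play a player unable to move on their turn wins. -}

module Defs where

open import Data.Nat using (ℕ; zero; suc; _+_; _∸_; _<_; _≤_)
open import Data.List using (List; []; _∷_; _++_)
open import Data.List.Relation.Unary.All using (All)
open import Data.Product using (Σ; _×_)
open import Relation.Binary.PropositionalEquality using (_≡_)

-- A position of partizan Kayles: a disjunctive sum of strips, given as the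
-- list of the lengths of its empty strips (S_n is the strip of length n;
-- S_0 = 0, so zero entries contribute nothing).
Position : Set
Position = List ℕ

strip : ℕ → Position
strip zero    = []
strip (suc k) = suc k ∷ []

record LMove (G G′ : Position) : Set where
  constructor lmove
  field
    xs ys : Position
    n j   : ℕ
    j<n   : j < n
    pre   : G ≡ xs ++ n ∷ ys
    post  : G′ ≡ xs ++ strip j ++ strip (n ∸ suc j) ++ ys

record RMove (G G′ : Position) : Set where
  constructor rmove
  field
    xs ys : Position
    n j   : ℕ
    j+2≤n : j + 2 ≤ n
    pre   : G ≡ xs ++ n ∷ ys
    post  : G′ ≡ xs ++ strip j ++ strip (n ∸ (j + 2)) ++ ys

LeftStuck : Position → Set
LeftStuck G = All (λ n → n ≡ 0) G

RightStuck : Position → Set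
RightStuck G = All (λ n → n ≤ 1) G

-- Right (to move) has at least one move (otherwise Right wins under misère).
RightCanMove : Position → Set
RightCanMove G = Σ Position (λ G′ → RMove G G′)

-- Misère play outcomes (a player unable to move on their turn wins):
--  LeftWinsFirst G  : Left, moving first in G, has a winning strategy;
--  LeftWinsSecond G : Left wins G when Right moves first.
mutual
  data LeftWinsFirst (G : Position) : Set where
    stuckL : LeftStuck G → LeftWinsFirst G
    moveL  : (G′ : Position) → LMove G G′ → LeftWinsSecond G′ → LeftWinsFirst G

  data LeftWinsSecond (G : Position) : Set where
    respond : RightCanMove G → ((G′ : Position) → RMove G G′ → LeftWinsFirst G′) → LeftWinsSecond G

-- The heart of the proof is a comparison of sums: for Left, S₁ + S_a + S_b
-- is no better than the single strip S_{a+1+b} (the S₁ being the cell that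
-- separates S_a from S_b).  Whenever Left wins S₁ + S_a + S_b + G, moving
-- first or second, she also wins S_{a+1+b} + G ('merge-first' and
-- 'merge-second').  The translation of strategies is direct, except when
-- Right's domino covers the joining cell next to a strip S₁ (a = 1), where
-- we use that a second-player win of S₁ + S₁ + W is a first-player win of W
-- ('pair-second').  The corollary itself ('singleton-first') then follows:
-- a winning first move in S₁ + G either is the move to G, or splits some
-- strip S_{1+j+k} of G = S_{1+j+k} + H into S_j + S_k, and then merging
-- S₁ + S_j + S_k back into S_{1+j+k} shows that G is a second-player win.
-- These four statements are proved simultaneously by induction on the
-- number of empty cells.
--
-- Since outcomes only depend on the multiset of strip lengths, the argument
-- is carried out for outcome predicates defined up to permutation of the
-- strips (LFirst, LSecond), which are shown to agree with the outcome
-- predicates of Defs at the end.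

module Submission where

open import Defs
open import Data.List using (_∷_)
open import Data.Product using (_×_)

open import Data.Nat using (ℕ; zero; suc; pred; _+_; _∸_; _≤_; _<_; z≤n; s≤s; s≤s⁻¹)
open import Data.Nat.Properties
  using (+-suc; +-comm; +-assoc; +-identityʳ; m≤m+n; m+n∸m≡n; m+[n∸m]≡n; <⇒≤; n≤1+n; ≤-trans; ≤-refl)
open import Data.Nat.ListAction using (sum)
open import Data.Nat.ListAction.Properties using (sum-++; sum-↭)
open import Data.List using ([]; _++_; [_])
open import Data.List.Relation.Unary.All using (_∷_)
open import Data.List.Relation.Unary.Any using (here; there)
open import Data.List.Membership.Propositional using (_∈_)
open import Data.List.Membership.Propositional.Properties using (∈-∃++; ∈-++⁻)
open import Data.List.Relation.Binary.Permutation.Propositional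
  using (_↭_; ↭-refl; ↭-sym; ↭-trans; ↭-prep; ↭-swap; ↭-reflexive)
open import Data.List.Relation.Binary.Permutation.Propositional.Properties
  using (∈-resp-↭; All-resp-↭; shift; shifts; drop-∷; ++⁺ˡ)
open import Data.Product using (∃-syntax; ∃₂; _,_)
open import Data.Sum using (_⊎_; inj₁; inj₂)
open import Relation.Binary.PropositionalEquality using (_≡_; refl; sym; trans; cong; cong₂; subst; module ≡-Reasoning)

pieces : ℕ → ℕ → Position → Position
pieces j k R = strip j ++ strip k ++ R

extract : ∀ {x : ℕ} {xs} → x ∈ xs → ∃[ ys ] (xs ↭ x ∷ ys)
extract x∈xs with ∈-∃++ x∈xs
... | ys , zs , refl = ys ++ zs , shift _ ys zs

∷-↭-∷ : ∀ {x y : ℕ} {xs ys} → x ∷ xs ↭ y ∷ ys →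
        (x ≡ y × xs ↭ ys) ⊎ ∃[ zs ] (ys ↭ x ∷ zs × xs ↭ y ∷ zs)
∷-↭-∷ {x} {y} p with ∈-resp-↭ p (here refl)
... | here refl = inj₁ (refl , drop-∷ p)
... | there x∈ys with extract x∈ys
...   | zs , ys↭ = inj₂ (zs , ys↭ , drop-∷ (↭-trans p (↭-trans (↭-prep y ys↭) (↭-swap y x ↭-refl))))

occurrence : ∀ {n : ℕ} {G R} → G ↭ n ∷ R → ∃₂ λ xs ys → G ≡ xs ++ n ∷ ys × xs ++ ys ↭ R
occurrence p with ∈-∃++ (∈-resp-↭ (↭-sym p) (here refl))
... | xs , ys , refl = xs , ys , refl , drop-∷ (↭-trans (↭-sym (shift _ xs ys)) p)

pieces-↭ : ∀ j k {R R′} → R ↭ R′ → pieces j k R ↭ pieces j k R′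
pieces-↭ j k r = ++⁺ˡ (strip j) (++⁺ˡ (strip k) r)

pieces-front : ∀ xs j k ys → xs ++ pieces j k ys ↭ pieces j k (xs ++ ys)
pieces-front xs j k ys = ↭-trans (shifts xs (strip j)) (++⁺ˡ (strip j) (shifts xs (strip k)))

pieces-cons : ∀ j k x R → pieces j k (x ∷ R) ↭ x ∷ pieces j k R
pieces-cons j k x R = ↭-sym (pieces-front [ x ] j k R)

pieces-interchange : ∀ a b j k G → pieces a b (pieces j k G) ↭ pieces j k (pieces a b G)
pieces-interchange a b j k G =
  ↭-trans (++⁺ˡ (strip a) (pieces-front (strip b) j k G)) (pieces-front (strip a) j k (strip b ++ G))

pieces-regroup : ∀ j k x b G → pieces j k (x ∷ strip b ++ G) ↭ x ∷ pieces k b (strip j ++ G)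
pieces-regroup j k x b G = ↭-trans (pieces-cons j k x (strip b ++ G)) (↭-prep x (pieces-front (strip j) k b G))

∈-strip : ∀ {n} a → n ∈ strip a → a ≡ n
∈-strip (suc a) (here refl) = refl

∈-pieces : ∀ {n} a b G → n ∈ pieces a b G → a ≡ n ⊎ b ≡ n ⊎ n ∈ G
∈-pieces a b G n∈ with ∈-++⁻ (strip a) n∈
... | inj₁ n∈a = inj₁ (∈-strip a n∈a)
... | inj₂ n∈rest with ∈-++⁻ (strip b) n∈rest
...   | inj₁ n∈b = inj₂ (inj₁ (∈-strip b n∈b))
...   | inj₂ n∈G = inj₂ (inj₂ n∈G)

locate : ∀ {m A} a b G → pieces a b G ↭ suc m ∷ A →
         (a ≡ suc m × A ↭ strip b ++ G) ⊎ (b ≡ suc m × A ↭ strip a ++ G) ⊎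
         ∃[ G′ ] (G ↭ suc m ∷ G′ × A ↭ pieces a b G′)
locate a b G p with ∈-pieces a b G (∈-resp-↭ (↭-sym p) (here refl))
... | inj₁ refl = inj₁ (refl , ↭-sym (drop-∷ p))
... | inj₂ (inj₁ refl) = inj₂ (inj₁ (refl , ↭-sym (drop-∷ (↭-trans (↭-sym (shift _ (strip a) G)) p))))
... | inj₂ (inj₂ m∈G) with extract m∈G
...   | G′ , G↭ = inj₂ (inj₂ (G′ , G↭ , ↭-sym (drop-∷ (↭-trans (↭-sym G↭′) p))))
  where
  G↭′ : pieces a b G ↭ _ ∷ pieces a b G′
  G↭′ = ↭-trans (pieces-↭ a b G↭) (pieces-cons a b _ G′)

cells : Position → ℕ
cells = sum

cells-strip : ∀ j → cells (strip j) ≡ j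
cells-strip zero    = refl
cells-strip (suc j) = cong suc (+-identityʳ j)

cells-pieces : ∀ j k R → cells (pieces j k R) ≡ j + k + cells R
cells-pieces j k R = begin
  cells (strip j ++ strip k ++ R)         ≡⟨ sum-++ (strip j) (strip k ++ R) ⟩
  cells (strip j) + cells (strip k ++ R)  ≡⟨ cong (cells (strip j) +_) (sum-++ (strip k) R) ⟩
  cells (strip j) + (cells (strip k) + cells R)
    ≡⟨ cong₂ (λ x y → x + (y + cells R)) (cells-strip j) (cells-strip k) ⟩
  j + (k + cells R)                       ≡⟨ sym (+-assoc j k (cells R)) ⟩
  j + k + cells R                         ∎
  where open ≡-Reasoning

cells-resp-↭ : ∀ {n G H} → G ↭ H → cells G ≤ n → cells H ≤ n
cells-resp-↭ G↭H = subst (_≤ _) (sum-↭ G↭H)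

left-move-cells : ∀ j k {n G R} → G ↭ suc (j + k) ∷ R → cells G ≤ suc n → cells (pieces j k R) ≤ n
left-move-cells j k {R = R} p c =
  s≤s⁻¹ (subst (_≤ _) (trans (sum-↭ p) (cong suc (sym (cells-pieces j k R)))) c)

right-move-cells : ∀ j k {n G R} → G ↭ suc (suc (j + k)) ∷ R → cells G ≤ suc n → cells (pieces j k R) < n
right-move-cells j k {R = R} p c =
  s≤s⁻¹ (subst (_≤ _) (trans (sum-↭ p) (cong (λ x → suc (suc x)) (sym (cells-pieces j k R)))) c)

DominoFits : Position → Set
DominoFits G = ∃[ m ] suc (suc m) ∈ G

fits-resp-↭ : ∀ {G H} → G ↭ H → DominoFits G → DominoFits H
fits-resp-↭ G↭H (m , m∈G) = m , ∈-resp-↭ G↭H m∈G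

-- A Left move
-- splits a strip S_{j+1+k} of G into S_j + S_k, a Right move splits a strip
-- S_{j+2+k}; the strip is picked up to permutation of the sum.
mutual
  data LFirst (G : Position) : Set where
    stuck : LeftStuck G → LFirst G
    split : ∀ j k {R} → G ↭ suc (j + k) ∷ R → LSecond (pieces j k R) → LFirst G

  data LSecond (G : Position) : Set where
    respond : DominoFits G →
              (∀ j k R → G ↭ suc (suc (j + k)) ∷ R → LFirst (pieces j k R)) → LSecond G

LFirst-resp-↭ : ∀ {G H} → G ↭ H → LFirst G → LFirst H
LFirst-resp-↭ G↭H (stuck s)   = stuck (All-resp-↭ G↭H s)
LFirst-resp-↭ G↭H (split j k p w) = split j k (↭-trans (↭-sym G↭H) p) w

LSecond-resp-↭ : ∀ {G H} → G ↭ H → LSecond G → LSecond H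
LSecond-resp-↭ G↭H (respond fits h) = respond (fits-resp-↭ G↭H fits) (λ j k R p → h j k R (↭-trans G↭H p))

split-of-one : ∀ j k R → 1 ≡ suc (j + k) → pieces j k R ≡ R
split-of-one zero zero R refl = refl

plus-two : ∀ j k → j + 2 + k ≡ suc (suc (j + k))
plus-two j k = trans (+-assoc j 2 k) (trans (+-suc j (suc k)) (cong suc (+-suc j k)))

-- Right's domino on the strip S_{a+1+b}, seen as S_a, a joining cell and
-- S_b, leaving S_j + S_k (so j + 1 + k = a + b).  DominoInFirst describes
-- the dominoes meeting the S_a part: lying inside S_a (leaving S_j + S_t of
-- it), or covering the last cell of S_a and the joining cell.
data DominoInFirst (a b j k : ℕ) : Set where
  inside : ∀ t → a ≡ suc (suc (j + t)) → k ≡ suc (t + b) → DominoInFirst a b j k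
  joint  : a ≡ suc j → k ≡ b → DominoInFirst a b j k

domino-view : ∀ a b j k → suc (j + k) ≡ a + b → DominoInFirst a b j k ⊎ DominoInFirst b a k j
domino-view zero          b zero     k e = inj₂ (joint (sym e) refl)
domino-view zero          b (suc j)  k e =
  inj₂ (inside j (trans (sym e) (cong (λ x → suc (suc x)) (+-comm j k))) (cong suc (sym (+-identityʳ j))))
domino-view (suc zero)    b zero     k e = inj₁ (joint refl (cong pred e))
domino-view (suc (suc a)) b zero     k e = inj₁ (inside a refl (cong pred e))
domino-view (suc a)       b (suc j)  k e with domino-view a b j k (cong pred e)
... | inj₁ (inside t a≡ k≡) = inj₁ (inside t (cong suc a≡) k≡)
... | inj₁ (joint a≡ k≡)    = inj₁ (joint (cong suc a≡) k≡)
... | inj₂ (inside t b≡ j≡) = inj₂ (inside t b≡ (cong suc (trans j≡ (sym (+-suc t a)))))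
... | inj₂ (joint b≡ j≡)    = inj₂ (joint b≡ (cong suc j≡))

fits-merge : ∀ a b G → DominoFits (1 ∷ pieces a b G) → DominoFits (suc (a + b) ∷ G)
fits-merge a b G (m , there m∈) with ∈-pieces a b G m∈
... | inj₁ refl         = suc (m + b) , here refl
... | inj₂ (inj₁ refl)  = suc (a + m) , here (cong suc (sym (trans (+-suc a (suc m)) (cong suc (+-suc a m)))))
... | inj₂ (inj₂ m∈G)   = m , there m∈G

mutual
  singleton-first : ∀ n G → cells (1 ∷ G) ≤ n → LFirst (1 ∷ G) → LSecond G
  singleton-first (suc n) G c (stuck (() ∷ _))
  singleton-first (suc n) G c (split j k {R} p w) with ∷-↭-∷ p
  ... | inj₁ (e , G↭R) = LSecond-resp-↭ (↭-trans (↭-reflexive (split-of-one j k R e)) (↭-sym G↭R)) w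
  ... | inj₂ (G′ , R↭ , G↭) =
    LSecond-resp-↭ (↭-sym G↭) (merge-second n j k G′ (cells-resp-↭ R↭′ (left-move-cells j k p c)) (LSecond-resp-↭ R↭′ w))
    where
    R↭′ : pieces j k R ↭ 1 ∷ pieces j k G′
    R↭′ = ↭-trans (pieces-↭ j k R↭) (pieces-cons j k 1 G′)

  merge-first : ∀ n a b G → cells (1 ∷ pieces a b G) ≤ n → LFirst (1 ∷ pieces a b G) → LFirst (suc (a + b) ∷ G)
  merge-first (suc n) a b G c (stuck (() ∷ _))
  merge-first (suc n) a b G c (split j k {R} p w) with ∷-↭-∷ p
  ... | inj₁ (e , P↭R) = split a b ↭-refl (LSecond-resp-↭ (↭-trans (↭-reflexive (split-of-one j k R e)) (↭-sym P↭R)) w)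
  ... | inj₂ (A , R↭ , P↭) with locate a b G P↭
  ...   | inj₁ (refl , A↭) =
    split-first-part n j k b G (cells-resp-↭ R↭′ (left-move-cells j k p c)) (LSecond-resp-↭ R↭′ w)
    where
    R↭′ : pieces j k R ↭ pieces j k (1 ∷ strip b ++ G)
    R↭′ = pieces-↭ j k (↭-trans R↭ (↭-prep 1 A↭))
  ...   | inj₂ (inj₁ (refl , A↭)) =
    subst (λ x → LFirst (suc x ∷ G)) (+-comm (suc (j + k)) a)
          (split-first-part n j k a G (cells-resp-↭ R↭′ (left-move-cells j k p c)) (LSecond-resp-↭ R↭′ w))
    where
    R↭′ : pieces j k R ↭ pieces j k (1 ∷ strip a ++ G)
    R↭′ = pieces-↭ j k (↭-trans R↭ (↭-prep 1 A↭))
  ...   | inj₂ (inj₂ (G′ , G↭ , A↭)) =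
    split j k (↭-trans (↭-prep _ G↭) (↭-swap _ _ ↭-refl))
          (LSecond-resp-↭ (↭-sym (pieces-cons j k _ G′))
                          (merge-second n a b (pieces j k G′) (cells-resp-↭ R↭′ (left-move-cells j k p c)) (LSecond-resp-↭ R↭′ w)))
    where
    R↭′ : pieces j k R ↭ 1 ∷ pieces a b (pieces j k G′)
    R↭′ = ↭-trans (pieces-↭ j k (↭-trans R↭ (↭-prep 1 A↭)))
                  (↭-trans (pieces-cons j k 1 _) (↭-prep 1 (pieces-interchange j k a b G′)))

  -- Left splits the S_a = S_{j+1+k} part of S_{a+1+b}, as in S₁ + S_a + S_b.
  split-first-part : ∀ n j k b G → cells (pieces j k (1 ∷ strip b ++ G)) ≤ n →
                     LSecond (pieces j k (1 ∷ strip b ++ G)) → LFirst (suc (suc (j + k) + b) ∷ G)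
  split-first-part n j k b G c w =
    split j (suc (k + b)) (↭-reflexive (cong (_∷ G) length-eq))
          (LSecond-resp-↭ (↭-sym (shift _ (strip j) G))
                          (merge-second n k b (strip j ++ G) (cells-resp-↭ regroup c) (LSecond-resp-↭ regroup w)))
    where
    regroup : pieces j k (1 ∷ strip b ++ G) ↭ 1 ∷ pieces k b (strip j ++ G)
    regroup = pieces-regroup j k 1 b G
    length-eq : suc (suc (j + k) + b) ≡ suc (j + suc (k + b))
    length-eq = cong suc (trans (cong suc (+-assoc j k b)) (sym (+-suc j (k + b))))

  merge-second : ∀ n a b G → cells (1 ∷ pieces a b G) ≤ n → LSecond (1 ∷ pieces a b G) → LSecond (suc (a + b) ∷ G)
  merge-second (suc n) a b G c w@(respond fits h) = respond (fits-merge a b G fits) answer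
    where
    answer : ∀ j k R → suc (a + b) ∷ G ↭ suc (suc (j + k)) ∷ R → LFirst (pieces j k R)
    answer j k R p with ∷-↭-∷ p
    ... | inj₁ (e , G↭R) with domino-view a b j k (cong pred (sym e))
    ...   | inj₁ d = LFirst-resp-↭ (pieces-↭ j k G↭R) (domino-answer n a b j k G d c w)
    ...   | inj₂ d = LFirst-resp-↭ (↭-trans (shifts (strip k) (strip j)) (pieces-↭ j k G↭R))
                       (domino-answer n b a k j G d (cells-resp-↭ swap c) (LSecond-resp-↭ swap w))
      where
      swap : 1 ∷ pieces a b G ↭ 1 ∷ pieces b a G
      swap = ↭-prep 1 (shifts (strip a) (strip b))
    answer j k R p | inj₂ (G′ , R↭ , G↭) =
      LFirst-resp-↭ (↭-trans (↭-sym (pieces-cons j k _ G′)) (pieces-↭ j k (↭-sym R↭)))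
                    (merge-first n a b (pieces j k G′) (cells-resp-↭ mirror (<⇒≤ (right-move-cells j k pK c)))
                                 (LFirst-resp-↭ mirror (h j k _ pK)))
      where
      -- Right's move in G, played in S₁ + S_a + S_b + G instead.
      pK : 1 ∷ pieces a b G ↭ suc (suc (j + k)) ∷ 1 ∷ pieces a b G′
      pK = ↭-trans (↭-prep 1 (↭-trans (pieces-↭ a b G↭) (pieces-cons a b _ G′))) (↭-swap 1 _ ↭-refl)
      mirror : pieces j k (1 ∷ pieces a b G′) ↭ 1 ∷ pieces a b (pieces j k G′)
      mirror = ↭-trans (pieces-cons j k 1 _) (↭-prep 1 (pieces-interchange j k a b G′))

  -- Left's answer in S_{a+1+b} + G to a domino meeting the S_a part.
  domino-answer : ∀ n a b j k G → DominoInFirst a b j k → cells (1 ∷ pieces a b G) ≤ suc n →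
                  LSecond (1 ∷ pieces a b G) → LFirst (pieces j k G)
  domino-answer n .(suc (suc (j + t))) b j .(suc (t + b)) G (inside t refl refl) c (respond _ h) =
    LFirst-resp-↭ (↭-sym (shift _ (strip j) G))
                  (merge-first n t b (strip j ++ G) (cells-resp-↭ regroup (<⇒≤ (right-move-cells j t pK c)))
                               (LFirst-resp-↭ regroup (h j t _ pK)))
    where
    -- Right places the same domino inside S_a.
    pK : 1 ∷ pieces (suc (suc (j + t))) b G ↭ suc (suc (j + t)) ∷ 1 ∷ strip b ++ G
    pK = ↭-swap 1 (suc (suc (j + t))) ↭-refl
    regroup : pieces j t (1 ∷ strip b ++ G) ↭ 1 ∷ pieces t b (strip j ++ G)
    regroup = pieces-regroup j t 1 b G
  domino-answer n .1 b zero .b G (joint refl refl) c w = pair-second n (strip b ++ G) (s≤s⁻¹ c) w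
  domino-answer n .(suc (suc j)) b (suc j) .b G (joint refl refl) c (respond _ h) =
    subst (λ x → LFirst (suc x ∷ strip b ++ G)) (+-identityʳ j)
          (merge-first n j 0 (strip b ++ G) (cells-resp-↭ regroup (<⇒≤ (right-move-cells j 0 pK c)))
                       (LFirst-resp-↭ regroup (h j 0 _ pK)))
    where
    -- Right covers the last two cells of S_a instead.
    pK : 1 ∷ pieces (suc (suc j)) b G ↭ suc (suc (j + 0)) ∷ 1 ∷ strip b ++ G
    pK = subst (λ x → 1 ∷ pieces (suc (suc j)) b G ↭ suc (suc x) ∷ 1 ∷ strip b ++ G) (sym (+-identityʳ j))
               (↭-swap 1 _ ↭-refl)
    regroup : pieces j 0 (1 ∷ strip b ++ G) ↭ 1 ∷ pieces j 0 (strip b ++ G)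
    regroup = pieces-cons j 0 1 (strip b ++ G)

  -- A second-player win of S₁ + S₁ + W is a first-player win of W: Right
  -- cannot move on the two S₁, so he can move on some S_{m+2} of W; Left
  -- answers the move leaving S_m with the move leaving S_{m+1}.
  pair-second : ∀ n W → cells (1 ∷ W) ≤ n → LSecond (1 ∷ 1 ∷ W) → LFirst W
  pair-second (suc n) W c (respond (m , there (there m∈W)) h) with extract m∈W
  ... | W′ , W↭ =
    split 0 (suc m) W↭ (merge-second n 0 m W′ (≤-trans (n≤1+n _) c₁) (singleton-first n (1 ∷ strip m ++ W′) c₁ w₁))
    where
    pK : 1 ∷ 1 ∷ W ↭ suc (suc m) ∷ 1 ∷ 1 ∷ W′
    pK = ↭-trans (↭-prep 1 (↭-prep 1 W↭)) (shift _ (1 ∷ 1 ∷ []) W′)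
    regroup : pieces 0 m (1 ∷ 1 ∷ W′) ↭ 1 ∷ 1 ∷ strip m ++ W′
    regroup = shifts (strip m) (1 ∷ 1 ∷ [])
    c₁ : cells (1 ∷ 1 ∷ strip m ++ W′) ≤ n
    c₁ = cells-resp-↭ regroup (s≤s⁻¹ (right-move-cells 0 m pK (s≤s c)))
    w₁ : LFirst (1 ∷ 1 ∷ strip m ++ W′)
    w₁ = LFirst-resp-↭ regroup (h 0 m _ pK)

left-move-canonical : ∀ {G G′} → LMove G G′ → ∃[ j ] ∃[ k ] ∃[ R ] (G ↭ suc (j + k) ∷ R × G′ ↭ pieces j k R)
left-move-canonical (lmove xs ys n j j<n refl refl) =
  j , n ∸ suc j , xs ++ ys ,
  subst (λ x → xs ++ n ∷ ys ↭ x ∷ xs ++ ys) (sym (m+[n∸m]≡n j<n)) (shift n xs ys) ,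
  pieces-front xs j (n ∸ suc j) ys

right-move-canonical : ∀ {G G′} → RMove G G′ → ∃[ j ] ∃[ k ] ∃[ R ] (G ↭ suc (suc (j + k)) ∷ R × G′ ↭ pieces j k R)
right-move-canonical (rmove xs ys n j j+2≤n refl refl) =
  j , n ∸ (j + 2) , xs ++ ys ,
  subst (λ x → xs ++ n ∷ ys ↭ x ∷ xs ++ ys) (trans (sym (m+[n∸m]≡n j+2≤n)) (plus-two j _)) (shift n xs ys) ,
  pieces-front xs j (n ∸ (j + 2)) ys

left-move-realize : ∀ j k {G R} → G ↭ suc (j + k) ∷ R → ∃[ G′ ] (LMove G G′ × G′ ↭ pieces j k R)
left-move-realize j k {R = R} p with occurrence p
... | xs , ys , refl , r = _ , lmove xs ys (suc (j + k)) j (s≤s (m≤m+n j k)) refl refl , G′↭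
  where
  G′↭ : xs ++ pieces j (suc (j + k) ∸ suc j) ys ↭ pieces j k R
  G′↭ rewrite m+n∸m≡n j k = ↭-trans (pieces-front xs j k ys) (pieces-↭ j k r)

right-move-realize : ∀ j k {G R} → G ↭ suc (suc (j + k)) ∷ R → ∃[ G′ ] (RMove G G′ × G′ ↭ pieces j k R)
right-move-realize j k {R = R} p with occurrence p
... | xs , ys , refl , r = _ , rmove xs ys (suc (suc (j + k))) j j+2≤ refl refl , G′↭
  where
  j+2≤ : j + 2 ≤ suc (suc (j + k))
  j+2≤ = subst (j + 2 ≤_) (plus-two j k) (m≤m+n (j + 2) k)
  G′↭ : xs ++ pieces j (suc (suc (j + k)) ∸ (j + 2)) ys ↭ pieces j k R
  G′↭ rewrite sym (plus-two j k) | m+n∸m≡n (j + 2) k = ↭-trans (pieces-front xs j k ys) (pieces-↭ j k r)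

mutual
  fromLeftWinsFirst : ∀ {G} → LeftWinsFirst G → LFirst G
  fromLeftWinsFirst (stuckL s) = stuck s
  fromLeftWinsFirst (moveL _ m w) with left-move-canonical m
  ... | j , k , R , p , G′↭ = split j k p (LSecond-resp-↭ G′↭ (fromLeftWinsSecond w))

  fromLeftWinsSecond : ∀ {G} → LeftWinsSecond G → LSecond G
  fromLeftWinsSecond (respond (_ , m) h) with right-move-canonical m
  ... | j , k , _ , p , _ =
    respond (j + k , ∈-resp-↭ (↭-sym p) (here refl))
            (λ j′ k′ R′ p′ → let (G″ , m′ , G″↭) = right-move-realize j′ k′ p′
                             in LFirst-resp-↭ G″↭ (fromLeftWinsFirst (h G″ m′)))

-- Conversely; the permutation G ↭ H is carried along so that the recursion
-- stays structural on the strategy.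
mutual
  toLeftWinsFirst : ∀ {G H} → G ↭ H → LFirst G → LeftWinsFirst H
  toLeftWinsFirst G↭H (stuck s) = stuckL (All-resp-↭ G↭H s)
  toLeftWinsFirst G↭H (split j k p w) with left-move-realize j k (↭-trans (↭-sym G↭H) p)
  ... | G′ , m , G′↭ = moveL G′ m (toLeftWinsSecond (↭-sym G′↭) w)

  toLeftWinsSecond : ∀ {G H} → G ↭ H → LSecond G → LeftWinsSecond H
  toLeftWinsSecond G↭H (respond (m , m∈G) h) with extract (∈-resp-↭ G↭H m∈G)
  ... | _ , H↭ with right-move-realize 0 m H↭
  ...   | G′ , mv , _ =
    respond (G′ , mv)
            (λ G″ m′ → let (j , k , R , p , G″↭) = right-move-canonical m′
                       in toLeftWinsFirst (↭-sym G″↭) (h j k R (↭-trans G↭H p)))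

corollary2p3 : (G : Position) → LeftWinsFirst (1 ∷ G) → LMove (1 ∷ G) G × LeftWinsSecond G
corollary2p3 G w =
  lmove [] G 1 0 (s≤s z≤n) refl refl ,
  toLeftWinsSecond ↭-refl (singleton-first (cells (1 ∷ G)) G ≤-refl (fromLeftWinsFirst w))
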